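{- Let $M$ be a matroid, let $B$ be a base of $M$, and let $F_1,F_2$ be bases of $M^{\mathrm{fin}}$ with $B\subseteq F_1$ and $B\subseteq F_2$. Then either $F_1\setminus B$ and $F_2\setminus B$ are both infinite, or both are finite and $|F_1\setminus B|=|F_2\setminus B|$.
   Context: A matroid is a pair $M=(E,\mathcal L)$, where $E$ is a possibly infinite set and $\mathcal L\subseteq 2^E$ satisfies: (I1) $\emptyset\in\mathcal L$; (I2) if $B\in\mathcal L$ and $A\subseteq B$ then $A\in\mathcal L$; (I3) if $B$ is a maximal element of $\mathcal L$ and $A\in\mathcal L$ is not maximal, then there is $b\in B\setminus A$ with $A\cup\{b\}\in\mathcal L$; (I4) if $A\in\mathcal L$ and $A\subseteq X\subseteq E$, then $\{S\in\mathcal L: A\subseteq S\subseteq X\}$ has a maximal element. Maximal independent sets are bases. The finitarization is $M^{\mathrm{fin}}=(E,\mathcal L^{\mathrm{fin}})$, where $S\in\mathcal L^{\mathrm{fin}}$ iff every finite subset of $S$ is in $\mathcal L$; this is a matroid. -}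

module Defs where

open import Data.Nat using (ℕ)
open import Level using (Lift)
import Level
open import Data.Empty using (⊥)
open import Data.Product using (Σ; _×_; ∃)
open import Data.Sum using (_⊎_)
open import Data.List using (List; length)
open import Data.List.Membership.Propositional using (_∈_)
open import Data.List.Relation.Unary.Unique.Propositional using (Unique)
open import Relation.Nullary using (¬_; Dec)
open import Relation.Binary.PropositionalEquality using (_≡_)
open import Function.Bundles using (_⇔_)

LEM : Set₂
LEM = (P : Set₁) → Dec P

Subset : Set → Set₁
Subset E = E → Set

module _ {E : Set} where

  ∅ : Subset E
  ∅ _ = ⊥

  _⊆_ : Subset E → Subset E → Set
  A ⊆ B = ∀ x → A x → B x

  _∖_ : Subset E → Subset E → Subset E
  (A ∖ B) x = A x × ¬ B x

  _∪⟨_⟩ : Subset E → E → Subset E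
  (A ∪⟨ b ⟩) x = A x ⊎ (x ≡ b)

  HasSize : Subset E → ℕ → Set
  HasSize S n = Σ (List E) λ xs → Unique xs × (length xs ≡ n) × (∀ x → (S x ⇔ (x ∈ xs)))

  Finite : Subset E → Set
  Finite S = ∃ λ n → HasSize S n

  Infinite : Subset E → Set
  Infinite S = ¬ Finite S

  Maximal : (Subset E → Set₁) → Subset E → Set₁
  Maximal 𝓛 S = 𝓛 S × (∀ T → 𝓛 T → S ⊆ T → T ⊆ S)

record Matroid (E : Set) : Set₂ where
  field
    Indep : Subset E → Set₁
    I1 : Indep ∅
    I2 : ∀ A B → Indep B → A ⊆ B → Indep A
    I3 : ∀ A B → Maximal Indep B → Indep A → ¬ Maximal Indep A →
         Σ E λ b → (B ∖ A) b × Indep (A ∪⟨ b ⟩)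
    I4 : ∀ A X → Indep A → A ⊆ X →
         Σ (Subset E) λ S → Maximal (λ T → Indep T × Lift (Level.suc Level.zero) (A ⊆ T × T ⊆ X)) S

open Matroid public

module _ {E : Set} (M : Matroid E) where

  IsBase : Subset E → Set₁
  IsBase = Maximal (Indep M)

  -- Independent sets of the finitarization M^fin.
  IndepFin : Subset E → Set₁
  IndepFin S = ∀ T → T ⊆ S → Finite T → Indep M T

  IsBaseFin : Subset E → Set₁
  IsBaseFin = Maximal IndepFin

module Submission where

-- We show
-- that |F₂ ∖ B| ≤ |F₁ ∖ B| whenever the right-hand side is a finite number n;
-- by symmetry this gives the theorem.
--
-- Take distinct x₁ … x_r in F₂ ∖ B.  Each xᵢ ∉ F₁ depends on a finite part of
-- F₁, so there is a finite Z ⊆ F₁ containing F₁ ∖ B such that Z ∪ {xᵢ} is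
-- dependent for every such xᵢ.  Z is independent (a finite subset of F₁), and
-- so is C = (Z ∩ B) ∪ {x₁ … x_r} (a finite subset of F₂).  No element of C ∖ Z
-- can be added to Z, and the augmentation bound for M (proved by extending C
-- and Z to bases and using that bases with finite difference differ by the
-- same number of elements on both sides) gives |C ∖ Z| ≤ |Z ∖ C|.  Counting
-- inside F₁ ∖ B then yields r ≤ n.

open import Defs
open import Data.Nat using (ℕ; zero; suc; _+_; _≤_; _<_; z≤n; s≤s)
open import Data.Nat.Properties
  using (≤-refl; ≤-trans; ≤-antisym; <⇒≱; +-identityʳ; +-suc; +-comm; +-monoʳ-≤; suc-injective; module ≤-Reasoning)
open import Data.Product using (Σ; _×_; _,_; proj₁; proj₂)
open import Data.Sum using (_⊎_; inj₁; inj₂; map₁)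
open import Data.Unit using (⊤; tt)
open import Data.Empty using (⊥-elim)
open import Data.List using (List; []; _∷_; length; _++_; filter)
open import Data.List.Properties using (length-++)
open import Data.List.Membership.Propositional using (_∈_)
open import Data.List.Membership.Propositional.Properties using (∈-++⁺ˡ; ∈-++⁺ʳ; ∈-++⁻; ∈-filter⁻)
open import Data.List.Relation.Unary.Any using (here; there)
import Data.List.Relation.Unary.All as All
open import Data.List.Relation.Unary.AllPairs using ([]; _∷_)
open import Data.List.Relation.Unary.Unique.Propositional using (Unique)
import Data.List.Relation.Unary.Unique.Propositional.Properties as Unique
open import Relation.Nullary using (¬_; Dec; yes; no)
open import Relation.Nullary.Decidable using (decidable-stable)
open import Relation.Unary using (Decidable)
open import Relation.Unary.Properties using (∁?)
open import Relation.Binary.PropositionalEquality using (_≡_; refl; sym; trans; cong; subst)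
open import Function.Bundles using (_⇔_; mk⇔; Equivalence)
open import Function.Construct.Composition using (_⇔-∘_)
open import Function.Construct.Symmetry using (⇔-sym)
open import Level using (Lift; lift)
import Level

open Equivalence using (to; from)

_─_ : {E : Set} → Subset E → E → Subset E
(A ─ x) z = A z × ¬ z ≡ x

module Classical (lem : LEM) where

  dec : (A : Set) → Dec A
  dec A with lem (Lift (Level.suc Level.zero) A)
  ... | yes (lift a) = yes a
  ... | no ¬a = no (λ a → ¬a (lift a))

  stable : {A : Set} → ¬ ¬ A → A
  stable {A} = decidable-stable (dec A)

  stable₁ : {A : Set₁} → ¬ ¬ A → A
  stable₁ {A} = decidable-stable (lem A)

module FiniteSubsets (lem : LEM) {E : Set} where
  open Classical lem

  private variable
    P Q D : Subset E
    m n k : ℕ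
    x y : E

  AtMost : Subset E → ℕ → Set
  AtMost P n = ∀ xs → Unique xs → (∀ x → x ∈ xs → P x) → length xs ≤ n

  AtMost-mono : P ⊆ Q → m ≤ n → AtMost Q m → AtMost P n
  AtMost-mono P⊆Q m≤n bound xs u xs⊆P =
    ≤-trans (bound xs u (λ x x∈xs → P⊆Q x (xs⊆P x x∈xs))) m≤n

  remove : (ys : List E) → x ∈ ys → List E
  remove (_ ∷ ys) (here _) = ys
  remove (y ∷ ys) (there p) = y ∷ remove ys p

  length-remove : (ys : List E) (p : x ∈ ys) → length ys ≡ suc (length (remove ys p))
  length-remove (_ ∷ _) (here _) = refl
  length-remove (_ ∷ ys) (there p) = cong suc (length-remove ys p)

  ∈-remove : (ys : List E) (p : x ∈ ys) → y ∈ ys → ¬ y ≡ x → y ∈ remove ys p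
  ∈-remove (_ ∷ _) (here x≡z) (here y≡z) y≢x = ⊥-elim (y≢x (trans y≡z (sym x≡z)))
  ∈-remove (_ ∷ _) (here _) (there y∈ys) _ = y∈ys
  ∈-remove (_ ∷ _) (there _) (here y≡z) _ = here y≡z
  ∈-remove (_ ∷ ys) (there p) (there y∈ys) y≢x = there (∈-remove ys p y∈ys y≢x)

  unique-length-≤ : (xs ys : List E) → Unique xs → (∀ x → x ∈ xs → x ∈ ys) → length xs ≤ length ys
  unique-length-≤ [] ys _ _ = z≤n
  unique-length-≤ (x ∷ xs) ys (x∉xs ∷ u) xs⊆ys =
    subst (suc (length xs) ≤_) (sym (length-remove ys x∈ys)) (s≤s (unique-length-≤ xs _ u xs⊆rest))
    where
    x∈ys = xs⊆ys x (here refl)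
    xs⊆rest : ∀ z → z ∈ xs → z ∈ remove ys x∈ys
    xs⊆rest z z∈xs = ∈-remove ys x∈ys (xs⊆ys z (there z∈xs)) (λ z≡x → All.lookup x∉xs z∈xs (sym z≡x))

  HasSize⇒AtMost : HasSize P n → AtMost P n
  HasSize⇒AtMost (ys , _ , refl , P⇔ys) xs u xs⊆P =
    unique-length-≤ xs ys u (λ x x∈xs → to (P⇔ys x) (xs⊆P x x∈xs))

  size-≤ : HasSize P m → AtMost P n → m ≤ n
  size-≤ (ys , u , refl , P⇔ys) bound = bound ys u (λ x x∈ys → from (P⇔ys x) x∈ys)

  -- A set with bounded duplicate-free lists is finite: keep adding new elements
  -- to a list while (classically) possible; the bound n stops this after n + 1 steps.
  AtMost⇒Finite : AtMost P n → Finite P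
  AtMost⇒Finite {P} {n} bound = grow (suc n) [] [] (λ _ ()) ≤-refl
    where
    grow : (fuel : ℕ) (xs : List E) → Unique xs → (∀ x → x ∈ xs → P x) → n < length xs + fuel → Finite P
    grow zero xs u xs⊆P n<len =
      ⊥-elim (<⇒≱ (subst (n <_) (+-identityʳ _) n<len) (bound xs u xs⊆P))
    grow (suc fuel) xs u xs⊆P n<len with dec (Σ E λ x → P x × ¬ x ∈ xs)
    ... | yes (x , Px , x∉xs) =
      grow fuel (x ∷ xs) (All.tabulate (λ z∈xs x≡z → x∉xs (subst (_∈ xs) (sym x≡z) z∈xs)) ∷ u)
           x∷xs⊆P (subst (n <_) (+-suc (length xs) fuel) n<len)
      where
      x∷xs⊆P : ∀ z → z ∈ x ∷ xs → P z
      x∷xs⊆P z (here z≡x) = subst P (sym z≡x) Px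
      x∷xs⊆P z (there z∈xs) = xs⊆P z z∈xs
    ... | no none =
      length xs , xs , u , refl ,
      λ x → mk⇔ (λ Px → stable (λ x∉xs → none (x , Px , x∉xs))) (xs⊆P x)

  covered⇒Finite : (ys : List E) → (∀ x → P x → x ∈ ys) → Finite P
  covered⇒Finite ys P⊆ys =
    AtMost⇒Finite (λ xs u xs⊆P → unique-length-≤ xs ys u (λ x x∈xs → P⊆ys x (xs⊆P x x∈xs)))

  HasSize-resp : (∀ x → P x ⇔ Q x) → HasSize P n → HasSize Q n
  HasSize-resp P⇔Q (ys , u , len , P⇔ys) = ys , u , len , λ x → P⇔ys x ⇔-∘ ⇔-sym (P⇔Q x)

  HasSize-zero : HasSize P 0 → ¬ P x
  HasSize-zero ([] , _ , _ , P⇔[]) Px with to (P⇔[] _) Px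
  ... | ()

  empty-HasSize : (∀ x → ¬ P x) → HasSize P 0
  empty-HasSize empty = [] , [] , refl , λ x → mk⇔ (λ Px → ⊥-elim (empty x Px)) (λ ())

  HasSize-remove : HasSize P (suc m) → Σ E λ x → P x × HasSize (P ─ x) m
  HasSize-remove ([] , _ , () , _)
  HasSize-remove {P} (x ∷ xs , x∉xs ∷ u , len , P⇔x∷xs) =
    x , from (P⇔x∷xs x) (here refl) , xs , u , suc-injective len , λ z → mk⇔ (forward z) (backward z)
    where
    forward : ∀ z → (P ─ x) z → z ∈ xs
    forward z (Pz , z≢x) with to (P⇔x∷xs z) Pz
    ... | here z≡x = ⊥-elim (z≢x z≡x)
    ... | there z∈xs = z∈xs
    backward : ∀ z → z ∈ xs → (P ─ x) z
    backward z z∈xs = from (P⇔x∷xs z) (there z∈xs) , λ z≡x → All.lookup x∉xs z∈xs (sym z≡x)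

  HasSize-insert : HasSize P m → ¬ P y → HasSize (P ∪⟨ y ⟩) (suc m)
  HasSize-insert {P} {y = y} (ys , u , len , P⇔ys) y∉P =
    y ∷ ys , All.tabulate (λ z∈ys y≡z → y∉P (from (P⇔ys y) (subst (_∈ ys) (sym y≡z) z∈ys))) ∷ u ,
    cong suc len , λ z → mk⇔ (forward z) (backward z)
    where
    forward : ∀ z → (P ∪⟨ y ⟩) z → z ∈ y ∷ ys
    forward z (inj₁ Pz) = there (to (P⇔ys z) Pz)
    forward z (inj₂ z≡y) = here z≡y
    backward : ∀ z → z ∈ y ∷ ys → (P ∪⟨ y ⟩) z
    backward z (here z≡y) = inj₂ z≡y
    backward z (there z∈ys) = inj₁ (from (P⇔ys z) z∈ys)

  length-filter-split : (P? : Decidable P) (xs : List E) →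
    length xs ≡ length (filter P? xs) + length (filter (∁? P?) xs)
  length-filter-split P? [] = refl
  length-filter-split P? (x ∷ xs) with P? x
  ... | yes _ = cong suc (length-filter-split P? xs)
  ... | no _ = trans (cong suc (length-filter-split P? xs)) (sym (+-suc _ _))

  split-count : HasSize P n → HasSize D k → D ⊆ P → (xs : List E) → Unique xs →
    (∀ x → x ∈ xs → ¬ D x) → AtMost (λ x → x ∈ xs × ¬ P x) k → length xs ≤ n
  split-count {P} {n} {D} sizeP (ds , uds , refl , D⇔ds) D⊆P xs uxs xs∩D=∅ outside-bound = begin
    length xs                            ≡⟨ length-filter-split P? xs ⟩
    length inside + length outside       ≤⟨ +-monoʳ-≤ (length inside) outside≤ds ⟩
    length inside + length ds            ≡⟨ +-comm (length inside) (length ds) ⟩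
    length ds + length inside            ≡⟨ sym (length-++ ds) ⟩
    length (ds ++ inside)                ≤⟨ HasSize⇒AtMost sizeP (ds ++ inside) unique ds++inside⊆P ⟩
    n                                    ∎
    where
    open ≤-Reasoning
    P? : Decidable P
    P? x = dec (P x)
    inside = filter P? xs
    outside = filter (∁? P?) xs
    outside≤ds : length outside ≤ length ds
    outside≤ds = outside-bound outside (Unique.filter⁺ (∁? P?) uxs) (λ x x∈ → ∈-filter⁻ (∁? P?) {xs = xs} x∈)
    unique : Unique (ds ++ inside)
    unique = Unique.++⁺ uds (Unique.filter⁺ P? uxs)
      (λ {v} (v∈ds , v∈inside) → xs∩D=∅ v (proj₁ (∈-filter⁻ P? {xs = xs} v∈inside)) (from (D⇔ds v) v∈ds))
    ds++inside⊆P : ∀ v → v ∈ ds ++ inside → P v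
    ds++inside⊆P v v∈ with ∈-++⁻ ds v∈
    ... | inj₁ v∈ds = D⊆P v (from (D⇔ds v) v∈ds)
    ... | inj₂ v∈inside = proj₂ (∈-filter⁻ P? {xs = xs} v∈inside)

module MatroidFacts (lem : LEM) {E : Set} (M : Matroid E) where
  open Classical lem
  open FiniteSubsets lem {E}

  private variable
    A A′ B B₁ B₂ F F₁ F₂ S T X : Subset E
    n k : ℕ
    x : E
    L L′ : List E

  -- Contrapositive of (I3): an independent set that every base element either
  -- belongs to or makes dependent is itself a base.
  base-criterion : IsBase M B → Indep M S → (∀ b → B b → Indep M (S ∪⟨ b ⟩) → S b) → IsBase M S
  base-criterion {B} {S} base indS closed with lem (IsBase M S)
  ... | yes isBase = isBase
  ... | no notBase with I3 M S B base indS notBase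
  ...   | b , (Bb , b∉S) , indS+b = ⊥-elim (b∉S (closed b Bb indS+b))

  maximal-extension : Indep M A → A ⊆ X →
    Σ (Subset E) λ S → Indep M S × A ⊆ S × S ⊆ X × (∀ T → Indep M T → S ⊆ T → T ⊆ X → T ⊆ S)
  maximal-extension {A} {X} indA A⊆X with I4 M A X indA A⊆X
  ... | S , (indS , lift (A⊆S , S⊆X)) , maximal =
    S , indS , A⊆S , S⊆X ,
    λ T indT S⊆T T⊆X → maximal T (indT , lift ((λ z Az → S⊆T z (A⊆S z Az)) , T⊆X)) S⊆T

  base-extension : Indep M A → Σ (Subset E) λ B → IsBase M B × A ⊆ B
  base-extension indA with maximal-extension {X = λ _ → ⊤} indA (λ _ _ → tt)
  ... | B , indB , A⊆B , _ , maximal = B , (indB , λ T indT B⊆T → maximal T indT B⊆T (λ _ _ → tt)) , A⊆B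

  base-extension-within : IsBase M B → B ⊆ X → Indep M A → A ⊆ X →
    Σ (Subset E) λ S → IsBase M S × A ⊆ S × S ⊆ X
  base-extension-within {B} {X} base B⊆X indA A⊆X with maximal-extension indA A⊆X
  ... | S , indS , A⊆S , S⊆X , maximal = S , base-criterion base indS closed , A⊆S , S⊆X
    where
    closed : ∀ b → B b → Indep M (S ∪⟨ b ⟩) → S b
    closed b Bb indS+b = maximal (S ∪⟨ b ⟩) indS+b (λ _ → inj₁) S+b⊆X b (inj₂ refl)
      where
      S+b⊆X : (S ∪⟨ b ⟩) ⊆ X
      S+b⊆X z (inj₁ Sz) = S⊆X z Sz
      S+b⊆X z (inj₂ refl) = B⊆X b Bb

  base-exchange : IsBase M B₁ → IsBase M B₂ → (B₁ ∖ B₂) x →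
    Σ E λ y → (B₂ ∖ B₁) y × IsBase M ((B₁ ─ x) ∪⟨ y ⟩)
  base-exchange {B₁} {B₂} {x} base₁ base₂ (B₁x , x∉B₂)
    with I3 M (B₁ ─ x) B₂ base₂ (I2 M _ B₁ (proj₁ base₁) (λ _ → proj₁)) not-base
    where
    not-base : ¬ IsBase M (B₁ ─ x)
    not-base (_ , maximal) = proj₂ (maximal B₁ (proj₁ base₁) (λ _ → proj₁) x B₁x) refl
  ... | y , (B₂y , y∉B₁─x) , indep = y , (B₂y , y∉B₁) , base-criterion base₁ indep closed
    where
    y∉B₁ : ¬ B₁ y
    y∉B₁ B₁y = y∉B₁─x (B₁y , λ y≡x → x∉B₂ (subst B₂ y≡x B₂y))
    -- Adding back b = x would make B₁ ∪ {y} independent, contradicting maximality of B₁.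
    closed : ∀ b → B₁ b → Indep M (((B₁ ─ x) ∪⟨ y ⟩) ∪⟨ b ⟩) → ((B₁ ─ x) ∪⟨ y ⟩) b
    closed b B₁b indep′ with dec (b ≡ x)
    ... | no b≢x = inj₁ (B₁b , b≢x)
    ... | yes b≡x = ⊥-elim (y∉B₁ (proj₂ base₁ (B₁ ∪⟨ y ⟩) (I2 M _ _ indep′ B₁+y⊆) (λ _ → inj₁) y (inj₂ refl)))
      where
      B₁+y⊆ : (B₁ ∪⟨ y ⟩) ⊆ (((B₁ ─ x) ∪⟨ y ⟩) ∪⟨ b ⟩)
      B₁+y⊆ z (inj₂ z≡y) = inj₁ (inj₂ z≡y)
      B₁+y⊆ z (inj₁ B₁z) with dec (z ≡ x)
      ... | yes z≡x = inj₂ (trans z≡x (sym b≡x))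
      ... | no z≢x = inj₁ (inj₁ (B₁z , z≢x))

  -- Two bases whose difference B₁ ∖ B₂ has m elements satisfy |B₂ ∖ B₁| = m;
  -- by induction on m, exchanging one element at a time.
  exchange-size : (m : ℕ) → IsBase M B₁ → IsBase M B₂ → HasSize (B₁ ∖ B₂) m → HasSize (B₂ ∖ B₁) m
  exchange-size {B₁} {B₂} zero base₁ base₂ size =
    empty-HasSize λ z (B₂z , z∉B₁) → z∉B₁ (proj₂ base₁ B₂ (proj₁ base₂) B₁⊆B₂ z B₂z)
    where
    B₁⊆B₂ : B₁ ⊆ B₂
    B₁⊆B₂ z B₁z = stable (λ z∉B₂ → HasSize-zero size (B₁z , z∉B₂))
  exchange-size {B₁} {B₂} (suc m) base₁ base₂ size with HasSize-remove size
  ... | x , (B₁x , x∉B₂) , rest with base-exchange base₁ base₂ (B₁x , x∉B₂)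
  ... | y , (B₂y , y∉B₁) , base′ =
    HasSize-resp added (HasSize-insert (exchange-size m base′ base₂ (HasSize-resp removed rest)) (λ (_ , y∉B′) → y∉B′ (inj₂ refl)))
    where
    B′ = (B₁ ─ x) ∪⟨ y ⟩
    removed : ∀ z → ((B₁ ∖ B₂) ─ x) z ⇔ (B′ ∖ B₂) z
    removed z = mk⇔ (λ ((B₁z , z∉B₂) , z≢x) → inj₁ (B₁z , z≢x) , z∉B₂) backward
      where
      backward : (B′ ∖ B₂) z → ((B₁ ∖ B₂) ─ x) z
      backward (inj₁ (B₁z , z≢x) , z∉B₂) = (B₁z , z∉B₂) , z≢x
      backward (inj₂ z≡y , z∉B₂) = ⊥-elim (z∉B₂ (subst B₂ (sym z≡y) B₂y))
    added : ∀ z → ((B₂ ∖ B′) ∪⟨ y ⟩) z ⇔ (B₂ ∖ B₁) z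
    added z = mk⇔ forward backward
      where
      forward : ((B₂ ∖ B′) ∪⟨ y ⟩) z → (B₂ ∖ B₁) z
      forward (inj₁ (B₂z , z∉B′)) = B₂z , λ B₁z → z∉B′ (inj₁ (B₁z , λ z≡x → x∉B₂ (subst B₂ z≡x B₂z)))
      forward (inj₂ z≡y) = subst B₂ (sym z≡y) B₂y , λ B₁z → y∉B₁ (subst B₁ z≡y B₁z)
      backward : (B₂ ∖ B₁) z → ((B₂ ∖ B′) ∪⟨ y ⟩) z
      backward (B₂z , z∉B₁) with dec (z ≡ y)
      ... | yes z≡y = inj₂ z≡y
      ... | no z≢y = inj₁ (B₂z , λ { (inj₁ (B₁z , _)) → z∉B₁ B₁z ; (inj₂ z≡y) → z≢y z≡y })

  -- Extend A′ to a base B′ and A to a base S ⊆ A ∪ B′;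
  -- then S ∖ B′ ⊆ A ∖ A′, A′ ∖ A ⊆ B′ ∖ S, and |B′ ∖ S| = |S ∖ B′|.
  augmentation-bound : Indep M A → Indep M A′ → HasSize (A ∖ A′) k →
    (∀ a → (A′ ∖ A) a → ¬ Indep M (A ∪⟨ a ⟩)) → AtMost (A′ ∖ A) k
  augmentation-bound {A} {A′} {k} indA indA′ sizeA∖A′ no-augmentation with base-extension indA′
  ... | B′ , baseB′ , A′⊆B′
    with base-extension-within {X = λ z → A z ⊎ B′ z} baseB′ (λ _ → inj₂) indA (λ _ → inj₁)
  ... | S , baseS , A⊆S , S⊆A∪B′ = conclude (AtMost⇒Finite S∖B′-bound)
    where
    S∖B′⊆A∖A′ : (S ∖ B′) ⊆ (A ∖ A′)
    S∖B′⊆A∖A′ z (Sz , z∉B′) with S⊆A∪B′ z Sz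
    ... | inj₁ Az = Az , λ A′z → z∉B′ (A′⊆B′ z A′z)
    ... | inj₂ B′z = ⊥-elim (z∉B′ B′z)
    S∖B′-bound : AtMost (S ∖ B′) k
    S∖B′-bound = AtMost-mono S∖B′⊆A∖A′ ≤-refl (HasSize⇒AtMost sizeA∖A′)
    A′∖A⊆B′∖S : (A′ ∖ A) ⊆ (B′ ∖ S)
    A′∖A⊆B′∖S a (A′a , a∉A) = A′⊆B′ a A′a , λ Sa →
      no-augmentation a (A′a , a∉A) (I2 M _ S (proj₁ baseS) λ { z (inj₁ Az) → A⊆S z Az ; z (inj₂ refl) → Sa })
    conclude : Finite (S ∖ B′) → AtMost (A′ ∖ A) k
    conclude (m , sizeS∖B′) =
      AtMost-mono A′∖A⊆B′∖S (size-≤ sizeS∖B′ S∖B′-bound) (HasSize⇒AtMost (exchange-size m baseS baseB′ sizeS∖B′))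

  DependentOver : Subset E → List E → E → Set₁
  DependentOver F L x = Σ (Subset E) λ T → T ⊆ ((λ y → F y × y ∈ L) ∪⟨ x ⟩) × ¬ Indep M T

  DependentOver-mono : (∀ y → y ∈ L → y ∈ L′) → DependentOver F L x → DependentOver F L′ x
  DependentOver-mono L⊆L′ (T , T⊆ , dependent) =
    T , (λ z Tz → map₁ (λ (Fz , z∈L) → Fz , L⊆L′ z z∈L) (T⊆ z Tz)) , dependent

  finitary-dependence : IsBaseFin M F → ¬ F x → Σ (List E) λ L → DependentOver F L x
  finitary-dependence {F} {x} (_ , maximal) x∉F =
    stable₁ λ none → x∉F (maximal (F ∪⟨ x ⟩) (independent none) (λ _ → inj₁) x (inj₂ refl))
    where
    independent : ¬ (Σ (List E) λ L → DependentOver F L x) → IndepFin M (F ∪⟨ x ⟩)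
    independent none T T⊆F+x (_ , L , _ , _ , T⇔L) = stable₁ λ dependent →
      none (L , T , (λ z Tz → map₁ (λ Fz → Fz , to (T⇔L z) Tz) (T⊆F+x z Tz)) , dependent)

  finitary-dependence-list : IsBaseFin M F → (xs : List E) →
    Σ (List E) λ L → ∀ x → x ∈ xs → ¬ F x → DependentOver F L x
  finitary-dependence-list baseF [] = [] , λ _ ()
  finitary-dependence-list {F} baseF (x ∷ xs) with finitary-dependence-list baseF xs | dec (F x)
  ... | L , deps | yes Fx = L , λ { z (here refl) z∉F → ⊥-elim (z∉F Fx) ; z (there z∈xs) → deps z z∈xs }
  ... | L , deps | no x∉F with finitary-dependence baseF x∉F
  ...   | Lx , depx = Lx ++ L , λ
          { z (here refl) _ → DependentOver-mono (λ _ → ∈-++⁺ˡ) depx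
          ; z (there z∈xs) z∉F → DependentOver-mono (λ _ → ∈-++⁺ʳ Lx) (deps z z∈xs z∉F) }

  finite-part-independent : IndepFin M F → T ⊆ F → (ys : List E) → (∀ z → T z → z ∈ ys) → Indep M T
  finite-part-independent indF T⊆F ys T⊆ys = indF _ T⊆F (covered⇒Finite ys T⊆ys)

  difference-bound : IsBaseFin M F₁ → IsBaseFin M F₂ → B ⊆ F₂ → HasSize (F₁ ∖ B) n → AtMost (F₂ ∖ B) n
  difference-bound {F₁} {F₂} {B} base₁ base₂ B⊆F₂ size₁@(d , _ , _ , F₁∖B⇔d) xs uxs xs⊆F₂∖B
    with finitary-dependence-list base₁ xs
  ... | L , deps = split-count size₁ (proj₂ Z∖C-finite) Z∖C⊆F₁∖B xs uxs (λ x x∈xs (_ , x∉C) → x∉C (inj₂ x∈xs)) outside-bound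
    where
    Z : Subset E
    Z y = F₁ y × (¬ B y ⊎ y ∈ L)
    C : Subset E
    C y = (Z y × B y) ⊎ y ∈ xs
    Z⊆d++L : ∀ y → Z y → y ∈ d ++ L
    Z⊆d++L y (F₁y , inj₁ y∉B) = ∈-++⁺ˡ (to (F₁∖B⇔d y) (F₁y , y∉B))
    Z⊆d++L y (F₁y , inj₂ y∈L) = ∈-++⁺ʳ d y∈L
    C⊆F₂ : C ⊆ F₂
    C⊆F₂ y (inj₁ (_ , By)) = B⊆F₂ y By
    C⊆F₂ y (inj₂ y∈xs) = proj₁ (xs⊆F₂∖B y y∈xs)
    C⊆list : ∀ y → C y → y ∈ (d ++ L) ++ xs
    C⊆list y (inj₁ (Zy , _)) = ∈-++⁺ˡ (Z⊆d++L y Zy)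
    C⊆list y (inj₂ y∈xs) = ∈-++⁺ʳ (d ++ L) y∈xs
    Z∖C⊆F₁∖B : (Z ∖ C) ⊆ (F₁ ∖ B)
    Z∖C⊆F₁∖B y (Zy , y∉C) = proj₁ Zy , λ By → y∉C (inj₁ (Zy , By))
    Z∖C-finite : Finite (Z ∖ C)
    Z∖C-finite = covered⇒Finite d (λ y y∈ → to (F₁∖B⇔d y) (Z∖C⊆F₁∖B y y∈))
    -- An element a ∈ C ∖ Z lies in xs and outside F₁, so it depends on Z.
    no-augmentation : ∀ a → (C ∖ Z) a → ¬ Indep M (Z ∪⟨ a ⟩)
    no-augmentation a (inj₁ (Za , _) , a∉Z) _ = a∉Z Za
    no-augmentation a (inj₂ a∈xs , a∉Z) indep with deps a a∈xs (λ F₁a → a∉Z (F₁a , inj₁ (proj₂ (xs⊆F₂∖B a a∈xs))))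
    ... | T , T⊆ , dependent = dependent (I2 M T (Z ∪⟨ a ⟩) indep λ z Tz → map₁ (λ (F₁z , z∈L) → F₁z , inj₂ z∈L) (T⊆ z Tz))
    outside-bound : AtMost (λ x → x ∈ xs × ¬ (F₁ ∖ B) x) (proj₁ Z∖C-finite)
    outside-bound = AtMost-mono outside⊆C∖Z ≤-refl
      (augmentation-bound (finite-part-independent (proj₁ base₁) (λ _ → proj₁) (d ++ L) Z⊆d++L)
                          (finite-part-independent (proj₁ base₂) C⊆F₂ ((d ++ L) ++ xs) C⊆list)
                          (proj₂ Z∖C-finite) no-augmentation)
      where
      outside⊆C∖Z : (λ x → x ∈ xs × ¬ (F₁ ∖ B) x) ⊆ (C ∖ Z)
      outside⊆C∖Z x (x∈xs , x∉F₁∖B) = inj₂ x∈xs , λ (F₁x , _) → x∉F₁∖B (F₁x , proj₂ (xs⊆F₂∖B x x∈xs))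

-- If F₁ ∖ B is infinite, so is F₂ ∖ B (a finite size would bound F₁ ∖ B);
-- if it is finite, the key estimate in both directions gives equal sizes.
theorem3p1p1 : LEM → {E : Set} (M : Matroid E) (B F₁ F₂ : Subset E) →
    IsBase M B → IsBaseFin M F₁ → IsBaseFin M F₂ → B ⊆ F₁ → B ⊆ F₂ →
    (Infinite (F₁ ∖ B) × Infinite (F₂ ∖ B)) ⊎
    (Σ ℕ λ n → HasSize (F₁ ∖ B) n × HasSize (F₂ ∖ B) n)
theorem3p1p1 lem {E} M B F₁ F₂ _ base₁ base₂ B⊆F₁ B⊆F₂ = compare (dec (Finite (F₁ ∖ B)))
  where
  open Classical lem
  open FiniteSubsets lem {E}
  open MatroidFacts lem M
  compare : Dec (Finite (F₁ ∖ B)) →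
    (Infinite (F₁ ∖ B) × Infinite (F₂ ∖ B)) ⊎ (Σ ℕ λ n → HasSize (F₁ ∖ B) n × HasSize (F₂ ∖ B) n)
  compare (no infinite₁) =
    inj₁ (infinite₁ , λ (_ , size₂) → infinite₁ (AtMost⇒Finite (difference-bound base₂ base₁ B⊆F₁ size₂)))
  compare (yes (n , size₁)) = inj₂ (both-finite (AtMost⇒Finite (difference-bound base₁ base₂ B⊆F₂ size₁)))
    where
    both-finite : Finite (F₂ ∖ B) → Σ ℕ λ n → HasSize (F₁ ∖ B) n × HasSize (F₂ ∖ B) n
    both-finite (m , size₂) = n , size₁ , subst (HasSize (F₂ ∖ B)) m≡n size₂
      where
      m≡n : m ≡ n
      m≡n = ≤-antisym (size-≤ size₂ (difference-bound base₁ base₂ B⊆F₂ size₁))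
                      (size-≤ size₁ (difference-bound base₂ base₁ B⊆F₁ size₂))
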